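{- Let $b:\mathbb{N}\to\mathbb{N}\setminus\{0\}$ be a non-decreasing function with $b(t)\to\infty$ as $t\to\infty$. Consider the biased Maker–Breaker game on the board $K^{\aleph_0}$ (vertex set $\mathbb{N}$, all pairs as edges) in which Maker claims one unclaimed edge per turn and, on his $t$-th turn, Breaker claims $b(t)$ unclaimed edges. Maker wins if, after all turns have been played, her graph $G_M$ contains a complete subgraph on countably infinitely many vertices. Then Breaker has a winning strategy, i.e. he can ensure that $G_M$ contains no such complete subgraph.
   Context: Players alternate turns, each claiming previously unclaimed edges; the game lasts $\omega$ turns; $G_M$ is the graph of edges claimed by Maker; Breaker wins iff Maker does not. -}

module Defs where

open import Data.Nat using (ℕ; zero; suc; _≤_; _<_)
open import Data.Product using (_×_; _,_; proj₁; proj₂; Σ; ∃; ∃-syntax)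
open import Data.Sum using (_⊎_)
open import Data.List using (List; map; upTo; concatMap; length; _++_)
open import Data.List.Membership.Propositional using (_∈_; _∉_)
open import Data.List.Relation.Unary.All using (All)
open import Data.List.Relation.Unary.Unique.Propositional using (Unique)
open import Relation.Binary.PropositionalEquality using (_≡_)
open import Relation.Nullary using (¬_)
open import Function.Definitions using (Injective)

-- Board K^{ℵ₀}: vertex set ℕ, edges = 2-element subsets {i , j},
-- represented canonically as pairs (i , j) with i < j.
Edge : Set
Edge = ℕ × ℕ

ValidEdge : Edge → Set
ValidEdge e = proj₁ e < proj₂ e

IsBias : (ℕ → ℕ) → Set
IsBias b =
  (∀ t → 1 ≤ b t)
  × (∀ s t → s ≤ t → b s ≤ b t)
  × (∀ K → ∃[ T ] (∀ t → T ≤ t → K ≤ b t))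

-- A play is determined by Maker's sequence of moves  m : ℕ → Edge
-- (m n = Maker's edge in round n, rounds numbered 0,1,2,…) together with a
-- (deterministic) Breaker strategy, which maps the list of Maker's moves made
-- so far (rounds 0..n, i.e. Maker has just moved in round n) to the list of
-- edges Breaker claims in round n.  Breaker's own earlier moves are a function
-- of Maker's earlier moves, so this is a fully general Breaker strategy.
BreakerStrategy : Set
BreakerStrategy = List Edge → List Edge

makerMoves : (ℕ → Edge) → ℕ → List Edge
makerMoves m n = map m (upTo n)

breakerMove : BreakerStrategy → (ℕ → Edge) → ℕ → List Edge
breakerMove σ m n = σ (makerMoves m (suc n))

breakerMoves : BreakerStrategy → (ℕ → Edge) → ℕ → List Edge
breakerMoves σ m n = concatMap (breakerMove σ m) (upTo n)

MakerLegalAt : BreakerStrategy → (ℕ → Edge) → ℕ → Set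
MakerLegalAt σ m n =
  ValidEdge (m n)
  × m n ∉ makerMoves m n
  × m n ∉ breakerMoves σ m n

MakerLegalUpTo : BreakerStrategy → (ℕ → Edge) → ℕ → Set
MakerLegalUpTo σ m n = ∀ k → k ≤ n → MakerLegalAt σ m k

-- Breaker's move in round n (his (n+1)-th turn) is legal for bias b:
-- exactly b(n+1) distinct genuine edges, none of them claimed before
-- (by Maker in rounds 0..n, or by Breaker in rounds 0..n-1).
BreakerLegalAt : (ℕ → ℕ) → BreakerStrategy → (ℕ → Edge) → ℕ → Set
BreakerLegalAt b σ m n =
  length (breakerMove σ m n) ≡ b (suc n)
  × Unique (breakerMove σ m n)
  × All (λ e → ValidEdge e
               × e ∉ makerMoves m (suc n)
               × e ∉ breakerMoves σ m n) (breakerMove σ m n)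

InMakerGraph : (ℕ → Edge) → ℕ → ℕ → Set
InMakerGraph m x y =
  ∃[ k ] ((proj₁ (m k) ≡ x × proj₂ (m k) ≡ y) ⊎ (proj₁ (m k) ≡ y × proj₂ (m k) ≡ x))

HasInfiniteClique : (ℕ → Edge) → Set
HasInfiniteClique m =
  Σ (ℕ → ℕ) λ f → Injective _≡_ _≡_ f × (∀ i j → i < j → InMakerGraph m (f i) (f j))

BreakerWins : (ℕ → ℕ) → Set
BreakerWins b =
  Σ BreakerStrategy λ σ →
    (∀ (m : ℕ → Edge) n → MakerLegalUpTo σ m n → BreakerLegalAt b σ m n)
    × (∀ (m : ℕ → Edge) → (∀ n → MakerLegalAt σ m n) → ¬ HasInfiniteClique m)

module Submission where

-- Breaker answers Maker's edge e by claiming, greedily and oldest first, the edges that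
-- would close a triangle on e and an earlier Maker edge (four candidates per earlier edge),
-- topping his move up with fresh edges.  Once b(t) ≥ 4(i+1), the candidates coming from
-- Maker's first i+1 edges all fit into a single move.  If Maker had an infinite clique
-- containing her edge xy of round i, pick a clique vertex z that she first touches after
-- b has grown that large: whichever of xz, yz she claims first, Breaker answers by taking
-- the other.  Only b(t) → ∞ is used, not positivity or monotonicity of b.

open import Defs
open import Data.Nat using (ℕ; zero; suc; _+_; _*_; _∸_; _≤_; _<_; _≤′_; ≤′-refl; ≤′-step; _⊔_; _⊓_; z≤n; s≤s; _≤?_; _<?_; _≟_; z<s)
open import Data.Nat.Properties
open import Data.Product using (_×_; _,_; proj₁; proj₂; ∃; ∃-syntax)
open import Data.Product.Properties using (≡-dec)
open import Data.Sum using (_⊎_; inj₁; inj₂)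
open import Data.List using (List; []; _∷_; [_]; _++_; length; reverse; concatMap; cartesianProductWith; upTo; applyUpTo; applyDownFrom)
open import Data.List.Properties using (length-++; length-applyUpTo; length-applyDownFrom; ++-assoc; ++-identityʳ; concatMap-++; upTo-∷ʳ; map-upTo; reverse-applyUpTo)
open import Data.List.Extrema.Nat using (max; xs≤max)
open import Data.List.Relation.Unary.Any using (here; there)
open import Data.List.Relation.Unary.All as All using (All; []; _∷_)
open import Data.List.Relation.Unary.All.Properties using (¬Any⇒All¬) renaming (++⁺ to All-++⁺)
open import Data.List.Relation.Unary.AllPairs using ([]; _∷_)
open import Data.List.Relation.Unary.Unique.Propositional using (Unique)
open import Data.List.Relation.Unary.Unique.Propositional.Properties using (applyUpTo⁺₁) renaming (++⁺ to Unique-++⁺)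
open import Data.List.Membership.Propositional using (_∈_; _∉_; lose)
open import Data.List.Membership.Propositional.Properties
  using (∈-++⁺ˡ; ∈-++⁺ʳ; ∈-++⁻; ∈-map⁺; ∈-map⁻; ∈-concatMap⁺; ∈-cartesianProductWith⁺; ∈-upTo⁺; ∈-upTo⁻; ∈-applyUpTo⁻; ∈-applyDownFrom⁺; ∈-applyDownFrom⁻)
open import Data.Fin using (toℕ; fromℕ<)
open import Data.Fin.Properties using (pigeonhole; ¬∀⟶∃¬; fromℕ<-injective)
open import Data.Empty using (⊥-elim)
open import Function using (_∘_; case_of_)
open import Function.Definitions using (Injective)
open import Relation.Binary.Definitions using (tri<; tri≈; tri>)
open import Relation.Binary.PropositionalEquality hiding ([_])
open import Relation.Nullary using (¬_; Dec; yes; no; contradiction)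
open import Relation.Nullary.Decidable using (_×-dec_; ¬?)

open import Data.List.Membership.DecPropositional (≡-dec _≟_ _≟_) using (_∈?_)

Joins : Edge → ℕ → ℕ → Set
Joins e u v = (proj₁ e ≡ u × proj₂ e ≡ v) ⊎ (proj₁ e ≡ v × proj₂ e ≡ u)

endpoints : Edge → List ℕ
endpoints e = proj₁ e ∷ proj₂ e ∷ []

Joins⇒∈endpointsˡ : ∀ {e u v} → Joins e u v → u ∈ endpoints e
Joins⇒∈endpointsˡ (inj₁ (refl , _)) = here refl
Joins⇒∈endpointsˡ (inj₂ (_ , refl)) = there (here refl)

Joins⇒∈endpointsʳ : ∀ {e u v} → Joins e u v → v ∈ endpoints e
Joins⇒∈endpointsʳ (inj₁ (_ , refl)) = there (here refl)
Joins⇒∈endpointsʳ (inj₂ (refl , _)) = here refl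

Joins-unique : ∀ {e u v w} → Joins e u w → Joins e v w → u ≡ v ⊎ u ≡ w
Joins-unique (inj₁ (refl , _)) (inj₁ (refl , _)) = inj₁ refl
Joins-unique (inj₁ (refl , _)) (inj₂ (refl , _)) = inj₂ refl
Joins-unique (inj₂ (_ , refl)) (inj₁ (_ , refl)) = inj₂ refl
Joins-unique (inj₂ (_ , refl)) (inj₂ (_ , refl)) = inj₁ refl

edgeBetween : ℕ → ℕ → Edge
edgeBetween u v = u ⊓ v , u ⊔ v

Joins⇒≡edgeBetween : ∀ {e u v} → Joins e u v → ValidEdge e → e ≡ edgeBetween u v
Joins⇒≡edgeBetween (inj₁ (refl , refl)) u<v =
  sym (cong₂ _,_ (m≤n⇒m⊓n≡m (<⇒≤ u<v)) (m≤n⇒m⊔n≡n (<⇒≤ u<v)))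
Joins⇒≡edgeBetween (inj₂ (refl , refl)) v<u =
  sym (cong₂ _,_ (m≥n⇒m⊓n≡n (<⇒≤ v<u)) (m≥n⇒m⊔n≡m (<⇒≤ v<u)))

-- The four edges that would close a triangle with e₁ and e₂ if they shared a vertex.
closers : Edge → Edge → List Edge
closers e₁ e₂ = cartesianProductWith edgeBetween (endpoints e₁) (endpoints e₂)

∈-closers : ∀ {e₁ e₂ e v w} → v ∈ endpoints e₁ → w ∈ endpoints e₂ →
            Joins e v w → ValidEdge e → e ∈ closers e₁ e₂
∈-closers v∈e₁ w∈e₂ joins valid =
  subst (_∈ _) (sym (Joins⇒≡edgeBetween joins valid)) (∈-cartesianProductWith⁺ edgeBetween v∈e₁ w∈e₂)

-- Opaque, so that conversion checking never unfolds the maximum over symbolic edges.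
opaque
  vertexBound : List Edge → ℕ
  vertexBound es = max 0 (concatMap endpoints es)

opaque
  unfolding vertexBound

  ≤-vertexBound : ∀ {v e es} → v ∈ endpoints e → e ∈ es → v ≤ vertexBound es
  ≤-vertexBound {es = es} v∈e e∈es =
    All.lookup (xs≤max 0 (concatMap endpoints es)) (∈-concatMap⁺ endpoints (lose e∈es v∈e))

freshEdges : ℕ → ℕ → List Edge
freshEdges N K = applyUpTo (λ k → N , suc (N + k)) K

module _ {N K : ℕ} where

  length-freshEdges : length (freshEdges N K) ≡ K
  length-freshEdges = length-applyUpTo _ K

  freshEdges-unique : Unique (freshEdges N K)
  freshEdges-unique = applyUpTo⁺₁ _ K λ i<j _ eq →
    <⇒≢ i<j (+-cancelˡ-≡ N _ _ (suc-injective (cong proj₂ eq)))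

  freshEdges-valid : All ValidEdge (freshEdges N K)
  freshEdges-valid = All.tabulate λ e∈ → case ∈-applyUpTo⁻ _ e∈ of λ where
    (k , _ , refl) → s≤s (m≤m+n N k)

freshEdges-fresh : ∀ {es K e} → e ∈ freshEdges (suc (vertexBound es)) K → e ∉ es
freshEdges-fresh e∈ e∈es with ∈-applyUpTo⁻ _ e∈
... | _ , _ , refl = 1+n≰n (≤-vertexBound (here refl) e∈es)

module BreakerReply (B : ℕ) (claimed : List Edge) where

  Available : Edge → Set
  Available e = ValidEdge e × e ∉ claimed

  Admissible : List Edge → Edge → Set
  Admissible acc e = Available e × e ∉ acc × length acc < B

  admissible? : ∀ acc e → Dec (Admissible acc e)
  admissible? acc e =
    ((proj₁ e <? proj₂ e) ×-dec ¬? (e ∈? claimed)) ×-dec ¬? (e ∈? acc) ×-dec (length acc <? B)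

  greedy : List Edge → List Edge → List Edge
  greedy acc []       = acc
  greedy acc (e ∷ es) with admissible? acc e
  ... | yes _ = greedy (e ∷ acc) es
  ... | no  _ = greedy acc es

  GreedyInvariant : List Edge → Set
  GreedyInvariant acc = Unique acc × All Available acc × length acc ≤ B

  greedy-invariant : ∀ acc es → GreedyInvariant acc → GreedyInvariant (greedy acc es)
  greedy-invariant acc []       inv = inv
  greedy-invariant acc (e ∷ es) inv@(unique , available , _) with admissible? acc e
  ... | yes (e-available , e∉acc , room) =
    greedy-invariant (e ∷ acc) es (¬Any⇒All¬ acc e∉acc ∷ unique , e-available ∷ available , room)
  ... | no _ = greedy-invariant acc es inv

  greedy-⊇ : ∀ {e} acc es → e ∈ acc → e ∈ greedy acc es
  greedy-⊇ acc []        e∈acc = e∈acc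
  greedy-⊇ acc (x ∷ es) e∈acc with admissible? acc x
  ... | yes _ = greedy-⊇ (x ∷ acc) es (there e∈acc)
  ... | no  _ = greedy-⊇ acc es e∈acc

  ∈-greedy : ∀ {e} acc xs ys → e ∈ xs → Available e → length acc + length xs ≤ B →
             e ∈ greedy acc (xs ++ ys)
  ∈-greedy acc (x ∷ xs) ys e∈ e-available fits with admissible? acc x | e∈
  ... | yes _ | here refl  = greedy-⊇ (x ∷ acc) (xs ++ ys) (here refl)
  ... | yes _ | there e∈xs = ∈-greedy (x ∷ acc) xs ys e∈xs e-available (subst (_≤ B) (+-suc _ _) fits)
  ... | no  _ | there e∈xs =
    ∈-greedy acc xs ys e∈xs e-available (≤-trans (+-monoʳ-≤ (length acc) (n≤1+n _)) fits)
  ... | no ¬admissible | here refl with x ∈? acc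
  ...   | yes x∈acc = greedy-⊇ acc (xs ++ ys) x∈acc
  ...   | no  x∉acc = contradiction (e-available , x∉acc , <-≤-trans (m<m+n (length acc) z<s) fits) ¬admissible

  chosen : List Edge → List Edge
  chosen = greedy []

  reply : List Edge → List Edge
  reply cands = chosen cands ++ freshEdges (suc (vertexBound (claimed ++ chosen cands))) (B ∸ length (chosen cands))

  chosen-invariant : ∀ cands → GreedyInvariant (chosen cands)
  chosen-invariant cands = greedy-invariant [] cands ([] , [] , z≤n)

  length-reply : ∀ cands → length (reply cands) ≡ B
  length-reply cands with _ , _ , fits ← chosen-invariant cands =
    trans (length-++ (chosen cands)) (trans (cong (length (chosen cands) +_) length-freshEdges) (m+[n∸m]≡n fits))

  reply-unique : ∀ cands → Unique (reply cands)
  reply-unique cands with unique , _ ← chosen-invariant cands =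
    Unique-++⁺ unique freshEdges-unique (λ (p , q) → freshEdges-fresh q (∈-++⁺ʳ claimed p))

  reply-available : ∀ cands → All Available (reply cands)
  reply-available cands with _ , available , _ ← chosen-invariant cands =
    All-++⁺ available (All.zipWith (λ (valid , e∉) → valid , e∉ ∘ ∈-++⁺ˡ) (freshEdges-valid , All.tabulate freshEdges-fresh))

  ∈-reply : ∀ {e} xs ys → e ∈ xs → Available e → length xs ≤ B → e ∈ reply (xs ++ ys)
  ∈-reply xs ys e∈xs e-available fits = ∈-++⁺ˡ (∈-greedy [] xs ys e∈xs e-available fits)

module _ (m : ℕ → Edge) where

  ∈-makerMoves⁺ : ∀ {i n} → i < n → m i ∈ makerMoves m n
  ∈-makerMoves⁺ i<n = ∈-map⁺ m (∈-upTo⁺ i<n)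

  ∈-makerMoves⁻ : ∀ {e n} → e ∈ makerMoves m n → ∃ λ i → i < n × e ≡ m i
  ∈-makerMoves⁻ e∈ with i , i∈ , refl ← ∈-map⁻ m e∈ = i , ∈-upTo⁻ i∈ , refl

  makerMoves-mono : ∀ {e r s} → r ≤ s → e ∈ makerMoves m r → e ∈ makerMoves m s
  makerMoves-mono r≤s e∈ with i , i<r , refl ← ∈-makerMoves⁻ e∈ = ∈-makerMoves⁺ (<-≤-trans i<r r≤s)

  reverse-makerMoves : ∀ n → reverse (makerMoves m n) ≡ applyDownFrom m n
  reverse-makerMoves n = trans (cong reverse (map-upTo m n)) (reverse-applyUpTo m n)

  beyond-vertexBound⇒late : ∀ {M r u z} → vertexBound (makerMoves m M) < z → Joins (m r) u z → M ≤ r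
  beyond-vertexBound⇒late z-new joins = ≮⇒≥ λ r<M →
    <⇒≱ z-new (≤-vertexBound (Joins⇒∈endpointsʳ joins) (∈-makerMoves⁺ r<M))

module _ (σ : BreakerStrategy) (m : ℕ → Edge) where

  breakerMoves-suc : ∀ n → breakerMoves σ m (suc n) ≡ breakerMoves σ m n ++ breakerMove σ m n
  breakerMoves-suc n = begin
    concatMap move (upTo (suc n))                ≡⟨ cong (concatMap move) (upTo-∷ʳ n) ⟨
    concatMap move (upTo n ++ [ n ])             ≡⟨ concatMap-++ move (upTo n) [ n ] ⟩
    concatMap move (upTo n) ++ (move n ++ [])    ≡⟨ cong (concatMap move (upTo n) ++_) (++-identityʳ (move n)) ⟩
    concatMap move (upTo n) ++ move n            ∎
    where
    open ≡-Reasoning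
    move : ℕ → List Edge
    move = breakerMove σ m

  breakerMoves-mono : ∀ {e r s} → r ≤′ s → e ∈ breakerMoves σ m r → e ∈ breakerMoves σ m s
  breakerMoves-mono         ≤′-refl              e∈ = e∈
  breakerMoves-mono {e} {s = suc s} (≤′-step r≤s) e∈ =
    subst (e ∈_) (sym (breakerMoves-suc s)) (∈-++⁺ˡ (breakerMoves-mono r≤s e∈))

injective⇒unbounded : ∀ {f : ℕ → ℕ} → Injective _≡_ _≡_ f → ∀ B → ∃ λ j → B < f j
injective⇒unbounded {f} f-injective B =
  let k , fk≰B = ¬∀⟶∃¬ (2 + B) (λ k → f (toℕ k) ≤ B) (λ k → f (toℕ k) ≤? B) not-bounded
  in toℕ k , ≰⇒> fk≰B
  where
  not-bounded : ¬ (∀ k → f (toℕ k) ≤ B)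
  not-bounded bounded
    with k , l , k<l , eq ← pigeonhole (n<1+n (suc B)) (λ k → fromℕ< (s≤s (bounded k)))
    = <⇒≢ k<l (f-injective (fromℕ<-injective _ _ _ _ eq))

Diverges : (ℕ → ℕ) → Set
Diverges b = ∀ K → ∃[ T ] (∀ t → T ≤ t → K ≤ b t)

-- Maker's histories are listed newest move first.
candidates : Edge → List Edge → List Edge
candidates e []       = []
candidates e (e' ∷ h) = candidates e h ++ closers e' e

length-candidates : ∀ e h → length (candidates e h) ≡ length h * 4
length-candidates e []       = refl
length-candidates e (e' ∷ h) =
  trans (length-++ (candidates e h)) (trans (cong (_+ 4) (length-candidates e h)) (+-comm (length h * 4) 4))

candidates-prefix : ∀ {m : ℕ → Edge} {e i r} → suc i ≤′ r →
                    ∃ λ R → candidates e (applyDownFrom m r) ≡ candidates e (applyDownFrom m (suc i)) ++ R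
candidates-prefix ≤′-refl = [] , sym (++-identityʳ _)
candidates-prefix {m} {e} {i} (≤′-step {r} i<r) with R , eq ← candidates-prefix {m} {e} i<r =
  R ++ closers (m r) e , trans (cong (_++ closers (m r) e) eq) (++-assoc (candidates e (applyDownFrom m (suc i))) R _)

module TriangleStrategy (b : ℕ → ℕ) where

  answer : Edge → List Edge → List Edge → List Edge
  answer e h c = BreakerReply.reply (b (suc (length h))) (e ∷ h ++ c) (candidates e h)

  breakerEdges : List Edge → List Edge
  breakerEdges []      = []
  breakerEdges (e ∷ h) = breakerEdges h ++ answer e h (breakerEdges h)

  respond : List Edge → List Edge
  respond []      = []
  respond (e ∷ h) = answer e h (breakerEdges h)

  σ : BreakerStrategy
  σ = respond ∘ reverse

  module _ (m : ℕ → Edge) where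

    breakerMove-σ : ∀ n → breakerMove σ m n ≡ respond (applyDownFrom m (suc n))
    breakerMove-σ n = cong respond (reverse-makerMoves m (suc n))

    breakerMoves-σ : ∀ n → breakerMoves σ m n ≡ breakerEdges (applyDownFrom m n)
    breakerMoves-σ zero    = refl
    breakerMoves-σ (suc n) = trans (breakerMoves-suc σ m n) (cong₂ _++_ (breakerMoves-σ n) (breakerMove-σ n))

    claimedBefore : ℕ → List Edge
    claimedBefore r = m r ∷ applyDownFrom m r ++ breakerEdges (applyDownFrom m r)

    σ-legal : ∀ n → BreakerLegalAt b σ m n
    σ-legal n = subst LegalMove (sym (breakerMove-σ n))
      ( trans (length-reply cands) (cong (b ∘ suc) (length-applyDownFrom m n))
      , reply-unique cands
      , All.map available⇒legal (reply-available cands))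
      where
      open BreakerReply (b (suc (length (applyDownFrom m n)))) (claimedBefore n)
      LegalMove : List Edge → Set
      LegalMove X = length X ≡ b (suc n) × Unique X
                  × All (λ e → ValidEdge e × e ∉ makerMoves m (suc n) × e ∉ breakerMoves σ m n) X
      cands : List Edge
      cands = candidates (m n) (applyDownFrom m n)
      available⇒legal : ∀ {e} → Available e → ValidEdge e × e ∉ makerMoves m (suc n) × e ∉ breakerMoves σ m n
      available⇒legal (valid , e∉) =
          valid
        , (λ e∈ → case ∈-makerMoves⁻ m e∈ of λ where
             (i , i<n , refl) → e∉ (∈-++⁺ˡ (∈-applyDownFrom⁺ m i<n)))
        , (λ e∈ → e∉ (∈-++⁺ʳ (m n ∷ applyDownFrom m n) (subst (_ ∈_) (breakerMoves-σ n) e∈)))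

    claimedBefore⇒claimed : ∀ {e r} → e ∈ claimedBefore r → e ∈ makerMoves m (suc r) ⊎ e ∈ breakerMoves σ m (suc r)
    claimedBefore⇒claimed {e} {r} e∈ with ∈-++⁻ (m r ∷ applyDownFrom m r) e∈
    ... | inj₁ e∈maker with i , i<r , refl ← ∈-applyDownFrom⁻ m e∈maker = inj₁ (∈-makerMoves⁺ m i<r)
    ... | inj₂ e∈breaker =
      inj₂ (breakerMoves-mono σ m {r = r} (≤′-step ≤′-refl) (subst (e ∈_) (sym (breakerMoves-σ r)) e∈breaker))

    closer-chosen : ∀ {i r e v w} → i < r → suc i * 4 ≤ b (suc r) → v ∈ endpoints (m i) → w ∈ endpoints (m r) →
                    Joins e v w → ValidEdge e → e ∉ claimedBefore r → e ∈ breakerMove σ m r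
    closer-chosen {i} {r} {e} i<r bias v∈ w∈ joins valid e∉
      with R , eq ← candidates-prefix {m} {m r} (≤⇒≤′ i<r)
      = subst (e ∈_) (sym (breakerMove-σ r)) (subst (λ cs → e ∈ reply cs) (sym eq) e∈reply)
      where
      open BreakerReply (b (suc (length (applyDownFrom m r)))) (claimedBefore r)
      early : List Edge
      early = candidates (m r) (applyDownFrom m (suc i))
      fits : length early ≤ b (suc (length (applyDownFrom m r)))
      fits = begin
        length early                         ≡⟨ length-candidates (m r) (applyDownFrom m (suc i)) ⟩
        length (applyDownFrom m (suc i)) * 4 ≡⟨ cong (_* 4) (length-applyDownFrom m (suc i)) ⟩
        suc i * 4                            ≤⟨ bias ⟩
        b (suc r)                            ≡⟨ cong (b ∘ suc) (length-applyDownFrom m r) ⟨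
        b (suc (length (applyDownFrom m r))) ∎
        where open ≤-Reasoning
      e∈reply : e ∈ reply (early ++ R)
      e∈reply = ∈-reply early R (∈-++⁺ʳ _ (∈-closers v∈ w∈ joins valid)) (valid , e∉) fits

    closer-claimed : ∀ {i r e v w} → i < r → suc i * 4 ≤ b (suc r) → v ∈ endpoints (m i) → w ∈ endpoints (m r) →
                     Joins e v w → ValidEdge e → e ∈ makerMoves m (suc r) ⊎ e ∈ breakerMoves σ m (suc r)
    closer-claimed {r = r} {e} i<r bias v∈ w∈ joins valid with e ∈? claimedBefore r
    ... | yes e∈ = claimedBefore⇒claimed e∈
    ... | no  e∉ = inj₂ (subst (e ∈_) (sym (breakerMoves-suc σ m r))
                           (∈-++⁺ʳ (breakerMoves σ m r) (closer-chosen i<r bias v∈ w∈ joins valid e∉)))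

    module _ (legal : ∀ n → MakerLegalAt σ m n) where

      triangle-blocked : ∀ {i r s v w} → i < r → r < s → suc i * 4 ≤ b (suc r) →
                         v ∈ endpoints (m i) → w ∈ endpoints (m r) → ¬ Joins (m s) v w
      triangle-blocked {s = s} i<r r<s bias v∈ w∈ joins
        with valid , ∉maker , ∉breaker ← legal s
        with closer-claimed i<r bias v∈ w∈ joins valid
      ... | inj₁ e∈ = ∉maker (makerMoves-mono m r<s e∈)
      ... | inj₂ e∈ = ∉breaker (breakerMoves-mono σ m (≤⇒≤′ r<s) e∈)

      no-late-triangle : ∀ {i T x y z r₁ r₂} → (∀ t → T ≤ t → suc i * 4 ≤ b t) →
                         vertexBound (makerMoves m (suc i + T)) < z →
                         Joins (m i) x y → Joins (m r₁) x z → Joins (m r₂) y z → x ≡ y ⊎ x ≡ z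
      no-late-triangle {i} {T} {x} {y} {z} {r₁} {r₂} bias-large z-new xy xz yz = case <-cmp r₁ r₂ of λ where
          (tri< r₁<r₂ _ _) → ⊥-elim (triangle-blocked (i<late xz) r₁<r₂ (bias-late xz)
                                       (Joins⇒∈endpointsʳ xy) (Joins⇒∈endpointsʳ xz) yz)
          (tri≈ _ r₁≡r₂ _) → Joins-unique xz (subst (λ r → Joins (m r) y z) (sym r₁≡r₂) yz)
          (tri> _ _ r₂<r₁) → ⊥-elim (triangle-blocked (i<late yz) r₂<r₁ (bias-late yz)
                                       (Joins⇒∈endpointsˡ xy) (Joins⇒∈endpointsʳ yz) xz)
        where
        late : ∀ {r u} → Joins (m r) u z → suc i + T ≤ r
        late = beyond-vertexBound⇒late m z-new
        i<late : ∀ {r u} → Joins (m r) u z → i < r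
        i<late joins = ≤-trans (m≤m+n (suc i) T) (late joins)
        bias-late : ∀ {r u} → Joins (m r) u z → suc i * 4 ≤ b (suc r)
        bias-late {r} joins = bias-large (suc r) (≤-trans (m≤n+m T (suc i)) (≤-trans (late joins) (n≤1+n r)))

  σ-wins : Diverges b → ∀ m → (∀ n → MakerLegalAt σ m n) → ¬ HasInfiniteClique m
  σ-wins diverges m legal (f , f-injective , clique)
    with i , xy ← clique 0 1 z<s
    with T , bias-large ← diverges (suc i * 4)
    with j , z-new ← injective⇒unbounded (suc-injective ∘ suc-injective ∘ f-injective)
                                         (vertexBound (makerMoves m (suc i + T)))
    with no-late-triangle m legal bias-large z-new xy
           (proj₂ (clique 0 (2 + j) z<s)) (proj₂ (clique 1 (2 + j) (s≤s z<s)))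
  ... | inj₁ x≡y = 0≢1+n (f-injective x≡y)
  ... | inj₂ x≡z = 0≢1+n (f-injective x≡z)

mainTheorem3 : (b : ℕ → ℕ) → IsBias b → BreakerWins b
mainTheorem3 b (_ , _ , diverges) = σ , (λ m n _ → σ-legal m n) , σ-wins diverges
  where open TriangleStrategy b
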